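{- Let $A$ be a finite alphabet with $|A| = a \ge 3$, let $n$ be a positive integer and $d$ a nonnegative integer. If $\gcd(a^{n-d}, n) = p$ for some prime $p$ and there exists a nontrivial universal partial word for $A^n$ with diamondicity $d$, then $d \in \{kn/p : k \in \{1,\dots,p-1\}\}$.
   Context: A partial word over $A$ is a finite sequence of characters from $A \cup \{\diamond\}$, where $\diamond \notin A$ is a wild-card symbol; a word over $A$ contains no $\diamond$. $A^n$ denotes the set of words of length $n$ over $A$. For $x = x_1\cdots x_n \in A^n$ and a partial word $w = w_1\cdots w_N$, the position $i$ ($0 \le i \le N-n$) covers $x$ if $x_j = w_{i+j}$ for every $1\le j\le n$ with $w_{i+j}\in A$. A universal partial word for $A^n$ is a partial word $w$ such that every word in $A^n$ is covered by exactly one position of $w$; it is trivial if it equals $\diamond^n$ or contains no $\diamond$, and nontrivial otherwise. A window is a string of $n$ consecutive characters of $w$; $w$ has diamondicity $d$ if every window contains exactly $d$ occurrences of $\diamond$ (for $a\ge 3$ every universal partial word has a well-defined diamondicity). -}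

module Defs where

open import Data.Nat using (ℕ; zero; suc; _+_; _<_; _≤_)
open import Data.Fin using (Fin; toℕ)
open import Data.Unit using (⊤)
open import Data.Maybe using (Maybe; just; nothing)
open import Data.List using (List; length; lookup; replicate; filter)
open import Data.Vec as Vec using (Vec)
open import Data.Product using (Σ; ∃; _×_; _,_)
open import Data.Sum using (_⊎_)
open import Relation.Binary.PropositionalEquality using (_≡_; _≢_)
open import Relation.Nullary using (¬_)

-- A partial word over the alphabet A = Fin a: `nothing` is the hole ◇.
PartialWord : ℕ → Set
PartialWord a = List (Maybe (Fin a))

_!_ : ∀ {a} → PartialWord a → ℕ → Maybe (Fin a)
List.[] ! _ = nothing
(c List.∷ w) ! zero = c
(c List.∷ w) ! suc i = w ! i

Compatible : ∀ {a} → Maybe (Fin a) → Fin a → Set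
Compatible nothing  x = ⊤
Compatible (just y) x = y ≡ x

Covers : ∀ {a n} → PartialWord a → ℕ → Vec (Fin a) n → Set
Covers {a} {n} w i x =
  (i + n ≤ length w) × ((j : Fin n) → Compatible (w ! (i + toℕ j)) (Vec.lookup x j))

Universal : ∀ {a} (n : ℕ) → PartialWord a → Set
Universal {a} n w = (x : Vec (Fin a) n) →
  Σ ℕ (λ i → Covers w i x × ((i′ : ℕ) → Covers w i′ x → i′ ≡ i))

IsHole : ∀ {a} → Maybe (Fin a) → Set
IsHole c = c ≡ nothing

holesIn : ∀ {a} → PartialWord a → ℕ → ℕ → ℕ
holesIn w i zero = 0
holesIn w i (suc n) with w ! i
... | nothing = suc (holesIn w (suc i) n)
... | just _  = holesIn w (suc i) n

HasDiamondicity : ∀ {a} (n : ℕ) → PartialWord a → ℕ → Set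
HasDiamondicity n w d = (i : ℕ) → i + n ≤ length w → holesIn w i n ≡ d

Nontrivial : ∀ {a} (n : ℕ) → PartialWord a → Set
Nontrivial n w = (w ≢ replicate n nothing) × Σ ℕ (λ i → (i < length w) × IsHole (w ! i))

-- A window with h holes covers exactly a ^ h words, and by universality the windows partition
-- A^n; so with d holes per window there are a ^ (n ∸ d) windows. Refining the count to the words
-- with a fixed letter at offset j shows that the number of holes in column j of the windows is
-- congruent to the number of windows modulo a. Consecutive columns differ only by the hole
-- indicators at j and at (number of windows) + j, so for a ≥ 2 these agree: the hole pattern is
-- periodic with period a ^ (n ∸ d), and by diamondicity also with period n, hence with period
-- p = gcd (a ^ (n ∸ d)) n. Thus d = (n / p) k with k the number of holes in one period, and
-- 0 < k < p because w has a hole but is not ◇^n.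
module Submission where

open import Defs
open import Data.Nat using (ℕ; suc; _*_; _∸_; _^_; _≤_; _<_)
open import Data.Nat.GCD using (gcd)
open import Data.Nat.Primality using (Prime)
open import Data.Product using (Σ; _×_)
open import Relation.Binary.PropositionalEquality using (_≡_)
open import Algebra.Properties.CommutativeSemigroup using (interchange; xy∙z≈xz∙y; x∙yz≈y∙xz)
open import Data.Empty using (⊥-elim)
open import Data.Fin as Fin using (Fin; toℕ)
open import Data.Fin.Properties using (toℕ-fromℕ<)
open import Data.List as List using (length; replicate)
open import Data.Maybe using (Maybe; just; nothing)
open import Data.Nat using (zero; _+_; z≤n; s≤s; z<s; s<s; s<s⁻¹; NonZero; >-nonZero; >-nonZero⁻¹)
open import Data.Nat.DivMod using (_%_; _/_; m≡m%n+[m/n]*n; [m+n]%n≡m%n; m%n<n; m<n⇒m%n≡m)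
open import Data.Nat.Divisibility using (_∣_; divides; ∣m+n∣m⇒∣n; m∣m*n; ∣1⇒≡1)
open import Data.Nat.GCD using (gcd-GCD; gcd[m,n]∣n; module Bézout)
open import Data.Nat.Properties
open import Data.Product using (_,_; proj₁; proj₂)
open import Data.Sum using (_⊎_; inj₁; inj₂)
open import Data.Unit using (tt)
open import Data.Vec as Vec using (Vec; []; _∷_; lookup)
open import Function using (_∘_)
open import Relation.Binary.PropositionalEquality using (refl; sym; trans; cong; cong₂; subst; _≢_; module ≡-Reasoning)
open import Relation.Nullary using (contradiction)

open import Algebra.Properties.Semiring.Sum +-*-semiring
  using (sum-syntax; sum-cong-≗; ∑-distrib-+; *-distribˡ-sum; *-distribʳ-sum; sum-replicate-zero)

-- Finite sums

sumTo : ℕ → (ℕ → ℕ) → ℕ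
sumTo zero    f = 0
sumTo (suc n) f = f 0 + sumTo n (f ∘ suc)

sumTo-cong : ∀ n {f g : ℕ → ℕ} → (∀ i → i < n → f i ≡ g i) → sumTo n f ≡ sumTo n g
sumTo-cong zero    f≗g = refl
sumTo-cong (suc n) f≗g = cong₂ _+_ (f≗g 0 z<s) (sumTo-cong n (λ i i<n → f≗g (suc i) (s<s i<n)))

sumTo-const : ∀ n k → sumTo n (λ _ → k) ≡ n * k
sumTo-const zero    k = refl
sumTo-const (suc n) k = cong (k +_) (sumTo-const n k)

sumTo-distrib-+ : ∀ n (f g : ℕ → ℕ) → sumTo n (λ i → f i + g i) ≡ sumTo n f + sumTo n g
sumTo-distrib-+ zero    f g = refl
sumTo-distrib-+ (suc n) f g = trans (cong (f 0 + g 0 +_) (sumTo-distrib-+ n (f ∘ suc) (g ∘ suc)))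
                                    (interchange +-commutativeSemigroup (f 0) (g 0) _ _)

*-distribˡ-sumTo : ∀ n k (f : ℕ → ℕ) → k * sumTo n f ≡ sumTo n (λ i → k * f i)
*-distribˡ-sumTo zero    k f = *-zeroʳ k
*-distribˡ-sumTo (suc n) k f = trans (*-distribˡ-+ k (f 0) _) (cong (k * f 0 +_) (*-distribˡ-sumTo n k (f ∘ suc)))

sumTo-++ : ∀ m n (f : ℕ → ℕ) → sumTo (m + n) f ≡ sumTo m f + sumTo n (λ i → f (m + i))
sumTo-++ zero    n f = refl
sumTo-++ (suc m) n f = trans (cong (f 0 +_) (sumTo-++ m n (f ∘ suc))) (sym (+-assoc (f 0) _ _))

sumTo-init-last : ∀ n (f : ℕ → ℕ) → sumTo (suc n) f ≡ sumTo n f + f n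
sumTo-init-last zero    f = +-comm (f 0) 0
sumTo-init-last (suc n) f = trans (cong (f 0 +_) (sumTo-init-last n (f ∘ suc))) (sym (+-assoc (f 0) _ _))

sumTo-single : ∀ n (f : ℕ → ℕ) {i₀} → i₀ < n → (∀ i → i < n → i ≢ i₀ → f i ≡ 0) → sumTo n f ≡ f i₀
sumTo-single (suc n) f {zero} _ vanish = begin
  f 0 + sumTo n (f ∘ suc)     ≡⟨ cong (f 0 +_) (sumTo-cong n (λ i i<n → vanish (suc i) (s<s i<n) λ ())) ⟩
  f 0 + sumTo n (λ _ → 0)     ≡⟨ cong (f 0 +_) (trans (sumTo-const n 0) (*-zeroʳ n)) ⟩
  f 0 + 0                     ≡⟨ +-identityʳ (f 0) ⟩
  f 0                         ∎
  where open ≡-Reasoning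
sumTo-single (suc n) f {suc i₀} (s<s i₀<n) vanish =
  trans (cong (_+ sumTo n (f ∘ suc)) (vanish 0 z<s λ ()))
        (sumTo-single n (f ∘ suc) i₀<n (λ i i<n i≢i₀ → vanish (suc i) (s<s i<n) (i≢i₀ ∘ suc-injective)))

sumTo-mono-≤ : ∀ n {f g : ℕ → ℕ} → (∀ i → f i ≤ g i) → sumTo n f ≤ sumTo n g
sumTo-mono-≤ zero    f≤g = z≤n
sumTo-mono-≤ (suc n) f≤g = +-mono-≤ (f≤g 0) (sumTo-mono-≤ n (f≤g ∘ suc))

term≤sumTo : ∀ n (f : ℕ → ℕ) {i} → i < n → f i ≤ sumTo n f
term≤sumTo (suc n) f {zero}  _          = m≤m+n (f 0) _
term≤sumTo (suc n) f {suc i} (s<s i<n) = ≤-trans (term≤sumTo n (f ∘ suc) i<n) (m≤n+m _ (f 0))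

-- Periodic sequences

Period : {A : Set} → (ℕ → A) → ℕ → Set
Period f p = ∀ x → f (x + p) ≡ f x

module _ {A : Set} {f : ℕ → A} where

  period-* : ∀ {p} → Period f p → ∀ c → Period f (c * p)
  period-*     f-p zero    x = cong f (+-identityʳ x)
  period-* {p} f-p (suc c) x = begin
    f (x + (p + c * p))   ≡⟨ cong f (trans (cong (x +_) (+-comm p (c * p))) (sym (+-assoc x (c * p) p))) ⟩
    f (x + c * p + p)     ≡⟨ f-p (x + c * p) ⟩
    f (x + c * p)         ≡⟨ period-* f-p c x ⟩
    f x                   ∎
    where open ≡-Reasoning

  period-gcd : ∀ {m n} → Period f m → Period f n → Period f (gcd m n)
  period-gcd {m} {n} f-m f-n x with Bézout.identity (gcd-GCD m n)
  ... | Bézout.+- u v g+vn≡um = begin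
    f (x + gcd m n)             ≡⟨ period-* f-n v (x + gcd m n) ⟨
    f (x + gcd m n + v * n)     ≡⟨ cong f (trans (+-assoc x _ _) (cong (x +_) g+vn≡um)) ⟩
    f (x + u * m)               ≡⟨ period-* f-m u x ⟩
    f x                         ∎
    where open ≡-Reasoning
  ... | Bézout.-+ u v g+um≡vn = begin
    f (x + gcd m n)             ≡⟨ period-* f-m u (x + gcd m n) ⟨
    f (x + gcd m n + u * m)     ≡⟨ cong f (trans (+-assoc x _ _) (cong (x +_) g+um≡vn)) ⟩
    f (x + v * n)               ≡⟨ period-* f-n v x ⟩
    f x                         ∎
    where open ≡-Reasoning

  period-% : ∀ {n} .{{_ : NonZero n}} → Period f n → ∀ x → f (x % n) ≡ f x
  period-% {n} f-n x = trans (sym (period-* f-n (x / n) (x % n))) (cong f (sym (m≡m%n+[m/n]*n x n)))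

  period-fromResidues : ∀ {n m} .{{_ : NonZero n}} → Period f n →
                        (∀ j → j < n → f (j + m) ≡ f j) → Period f m
  period-fromResidues {n} {m} f-n residue x = begin
    f (x + m)                    ≡⟨ cong (λ y → f (y + m)) (m≡m%n+[m/n]*n x n) ⟩
    f (x % n + q * n + m)        ≡⟨ cong f (xy∙z≈xz∙y +-commutativeSemigroup (x % n) (q * n) m) ⟩
    f (x % n + m + q * n)        ≡⟨ period-* f-n q (x % n + m) ⟩
    f (x % n + m)                ≡⟨ residue (x % n) (m%n<n x n) ⟩
    f (x % n)                    ≡⟨ period-% f-n x ⟩
    f x                          ∎
    where
    open ≡-Reasoning
    q = x / n

  partialPeriod-% : ∀ {n N} .{{_ : NonZero n}} → (∀ i → i + n < N → f (i + n) ≡ f i) →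
                    ∀ k → k < N → f k ≡ f (k % n)
  partialPeriod-% {n} {N} f-n k k<N =
    trans (cong f (m≡m%n+[m/n]*n k n)) (shift (k / n) (k % n) (subst (_< N) (m≡m%n+[m/n]*n k n) k<N))
    where
    shift : ∀ q r → r + q * n < N → f (r + q * n) ≡ f r
    shift zero    r _  = cong f (+-identityʳ r)
    shift (suc q) r lt = trans (cong f r+[1+q]n≡r+qn+n) (trans (f-n (r + q * n) (subst (_< N) r+[1+q]n≡r+qn+n lt))
                                                                (shift q r (≤-<-trans (+-monoʳ-≤ r (m≤n+m (q * n) n)) lt)))
      where
      r+[1+q]n≡r+qn+n : r + suc q * n ≡ r + q * n + n
      r+[1+q]n≡r+qn+n = trans (cong (r +_) (+-comm n (q * n))) (sym (+-assoc r (q * n) n))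

sumTo-period : ∀ {f : ℕ → ℕ} {p} → Period f p → ∀ q → sumTo (q * p) f ≡ q * sumTo p f
sumTo-period             f-p zero    = refl
sumTo-period {f} {p} f-p (suc q) = trans (sumTo-++ p (q * p) f)
  (cong (sumTo p f +_) (trans (sumTo-cong (q * p) (λ i _ → trans (cong f (+-comm p i)) (f-p i))) (sumTo-period f-p q)))

-- Counting the words covered by a window

δ : ∀ {m} → Fin m → Fin m → ℕ
δ Fin.zero    Fin.zero    = 1
δ Fin.zero    (Fin.suc _) = 0
δ (Fin.suc _) Fin.zero    = 0
δ (Fin.suc z) (Fin.suc y) = δ z y

δ-refl : ∀ {m} (z : Fin m) → δ z z ≡ 1
δ-refl Fin.zero    = refl
δ-refl (Fin.suc z) = δ-refl z

δ≡0⊎≡ : ∀ {m} (z y : Fin m) → δ z y ≡ 0 ⊎ z ≡ y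
δ≡0⊎≡ Fin.zero    Fin.zero    = inj₂ refl
δ≡0⊎≡ Fin.zero    (Fin.suc y) = inj₁ refl
δ≡0⊎≡ (Fin.suc z) Fin.zero    = inj₁ refl
δ≡0⊎≡ (Fin.suc z) (Fin.suc y) with δ≡0⊎≡ z y
... | inj₁ δ≡0 = inj₁ δ≡0
... | inj₂ refl = inj₂ refl

∑-const : ∀ m k → ∑[ y < m ] k ≡ m * k
∑-const zero    k = refl
∑-const (suc m) k = cong (k +_) (∑-const m k)

∑-δ-sift : ∀ {m} (z : Fin m) (g : Fin m → ℕ) → ∑[ y < m ] (δ z y * g y) ≡ g z
∑-δ-sift {suc m} Fin.zero    g = trans (cong (g Fin.zero + 0 +_) (sum-replicate-zero m)) (trans (+-identityʳ _) (+-identityʳ _))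
∑-δ-sift {suc m} (Fin.suc z) g = ∑-δ-sift z (g ∘ Fin.suc)

∑-δ : ∀ {m} (z : Fin m) → ∑[ y < m ] δ z y ≡ 1
∑-δ z = trans (sum-cong-≗ (λ y → sym (*-identityʳ (δ z y)))) (∑-δ-sift z (λ _ → 1))

module _ {a : ℕ} where

  𝟙-compatible : Maybe (Fin a) → Fin a → ℕ
  𝟙-compatible nothing  y = 1
  𝟙-compatible (just z) y = δ z y

  𝟙-hole : Maybe (Fin a) → ℕ
  𝟙-hole nothing  = 1
  𝟙-hole (just _) = 0

  𝟙-letter : Fin a → Maybe (Fin a) → ℕ
  𝟙-letter c nothing  = 0
  𝟙-letter c (just z) = δ c z

  columnWeight : Fin a → Maybe (Fin a) → ℕ
  columnWeight c ch = 𝟙-hole ch + a * 𝟙-letter c ch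

  𝟙-hole≤1 : ∀ ch → 𝟙-hole ch ≤ 1
  𝟙-hole≤1 nothing  = s≤s z≤n
  𝟙-hole≤1 (just _) = z≤n

  𝟙-compatible≡0⊎Compatible : ∀ ch y → 𝟙-compatible ch y ≡ 0 ⊎ Compatible ch y
  𝟙-compatible≡0⊎Compatible nothing  y = inj₂ tt
  𝟙-compatible≡0⊎Compatible (just z) y = δ≡0⊎≡ z y

  Compatible⇒𝟙-compatible≡1 : ∀ {ch y} → Compatible ch y → 𝟙-compatible ch y ≡ 1
  Compatible⇒𝟙-compatible≡1 {nothing}         _    = refl
  Compatible⇒𝟙-compatible≡1 {just z} {.z} refl = δ-refl z

  ∑-𝟙-compatible : ∀ ch → ∑[ y < a ] 𝟙-compatible ch y ≡ a ^ 𝟙-hole ch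
  ∑-𝟙-compatible nothing  = ∑-const a 1
  ∑-𝟙-compatible (just z) = ∑-δ z

  ∑-𝟙-compatible-δ : ∀ c ch → a * ∑[ y < a ] (𝟙-compatible ch y * δ c y) ≡ a ^ 𝟙-hole ch * columnWeight c ch
  ∑-𝟙-compatible-δ c nothing  = begin
    a * ∑[ y < a ] (δ c y + 0)   ≡⟨ cong (a *_) (trans (sum-cong-≗ (λ y → +-comm (δ c y) 0)) (∑-δ c)) ⟩
    a * 1                        ≡⟨ *-identityʳ (a * 1) ⟨
    a * 1 * (1 + 0)              ≡⟨ cong (λ t → a * 1 * (1 + t)) (*-zeroʳ a) ⟨
    a * 1 * (1 + a * 0)          ∎
    where open ≡-Reasoning
  ∑-𝟙-compatible-δ c (just z) = trans (cong (a *_) (∑-δ-sift z (δ c))) (sym (+-identityʳ (a * δ c z)))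

  𝟙-covers : ∀ {n} → PartialWord a → ℕ → Vec (Fin a) n → ℕ
  𝟙-covers w i []      = 1
  𝟙-covers w i (y ∷ x) = 𝟙-compatible (w ! i) y * 𝟙-covers w (suc i) x

  CompatibleAt : ∀ {n} → PartialWord a → ℕ → Vec (Fin a) n → Set
  CompatibleAt {n} w i x = (j : Fin n) → Compatible (w ! (i + toℕ j)) (lookup x j)

  sumWords : ∀ n → (Vec (Fin a) n → ℕ) → ℕ
  sumWords zero    f = f []
  sumWords (suc n) f = ∑[ y < a ] sumWords n (λ x → f (y ∷ x))

  sumWords-cong : ∀ n {f g : Vec (Fin a) n → ℕ} → (∀ x → f x ≡ g x) → sumWords n f ≡ sumWords n g
  sumWords-cong zero    f≗g = f≗g []
  sumWords-cong (suc n) f≗g = sum-cong-≗ {a} (λ y → sumWords-cong n (λ x → f≗g (y ∷ x)))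

  sumWords-distrib-+ : ∀ n (f g : Vec (Fin a) n → ℕ) → sumWords n (λ x → f x + g x) ≡ sumWords n f + sumWords n g
  sumWords-distrib-+ zero    f g = refl
  sumWords-distrib-+ (suc n) f g =
    trans (sum-cong-≗ {a} (λ y → sumWords-distrib-+ n (λ x → f (y ∷ x)) (λ x → g (y ∷ x)))) (∑-distrib-+ {a} _ _)

  *-distribˡ-sumWords : ∀ n k (f : Vec (Fin a) n → ℕ) → k * sumWords n f ≡ sumWords n (λ x → k * f x)
  *-distribˡ-sumWords zero    k f = refl
  *-distribˡ-sumWords (suc n) k f =
    trans (*-distribˡ-sum {a} k _) (sum-cong-≗ {a} (λ y → *-distribˡ-sumWords n k (λ x → f (y ∷ x))))

  sumWords-const : ∀ n k → sumWords n (λ _ → k) ≡ a ^ n * k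
  sumWords-const zero    k = sym (+-identityʳ k)
  sumWords-const (suc n) k = begin
    ∑[ y < a ] sumWords n (λ _ → k)   ≡⟨ sum-cong-≗ {a} (λ _ → sumWords-const n k) ⟩
    ∑[ y < a ] (a ^ n * k)             ≡⟨ ∑-const a (a ^ n * k) ⟩
    a * (a ^ n * k)                    ≡⟨ *-assoc a (a ^ n) k ⟨
    a ^ suc n * k                      ∎
    where open ≡-Reasoning

  sumWords-sumTo-comm : ∀ n m (g : ℕ → Vec (Fin a) n → ℕ) →
                        sumWords n (λ x → sumTo m (λ i → g i x)) ≡ sumTo m (λ i → sumWords n (g i))
  sumWords-sumTo-comm n zero    g = trans (sumWords-const n 0) (*-zeroʳ (a ^ n))
  sumWords-sumTo-comm n (suc m) g = trans (sumWords-distrib-+ n (g 0) _) (cong (sumWords n (g 0) +_) (sumWords-sumTo-comm n m (g ∘ suc)))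

  sumWords-∷-* : ∀ n (f : Fin a → ℕ) (g : Vec (Fin a) n → ℕ) →
                 sumWords (suc n) (λ x → f (Vec.head x) * g (Vec.tail x)) ≡ (∑[ y < a ] f y) * sumWords n g
  sumWords-∷-* n f g = begin
    ∑[ y < a ] sumWords n (λ x → f y * g x)   ≡⟨ sum-cong-≗ {a} (λ y → *-distribˡ-sumWords n (f y) g) ⟨
    ∑[ y < a ] (f y * sumWords n g)           ≡⟨ *-distribʳ-sum (sumWords n g) f ⟨
    (∑[ y < a ] f y) * sumWords n g           ∎
    where open ≡-Reasoning

  sumWords-lookup : ∀ n (j : Fin n) (g : Fin a → ℕ) → a * sumWords n (λ x → g (lookup x j)) ≡ a ^ n * ∑[ y < a ] g y
  sumWords-lookup (suc n) Fin.zero    g = begin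
    a * sumWords (suc n) (λ x → g (Vec.head x))               ≡⟨ cong (a *_) (sumWords-cong (suc n) λ x → *-identityʳ (g (Vec.head x))) ⟨
    a * sumWords (suc n) (λ x → g (Vec.head x) * 1)           ≡⟨ cong (a *_) (sumWords-∷-* n g (λ _ → 1)) ⟩
    a * ((∑[ y < a ] g y) * sumWords n (λ _ → 1))              ≡⟨ cong (λ t → a * ((∑[ y < a ] g y) * t)) (trans (sumWords-const n 1) (*-identityʳ _)) ⟩
    a * ((∑[ y < a ] g y) * a ^ n)                             ≡⟨ cong (a *_) (*-comm _ (a ^ n)) ⟩
    a * (a ^ n * ∑[ y < a ] g y)                               ≡⟨ *-assoc a (a ^ n) _ ⟨
    a ^ suc n * ∑[ y < a ] g y                                 ∎
    where open ≡-Reasoning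
  sumWords-lookup (suc n) (Fin.suc j) g = begin
    a * ∑[ y < a ] sumWords n (λ x → g (lookup x j))          ≡⟨ cong (a *_) (∑-const a _) ⟩
    a * (a * sumWords n (λ x → g (lookup x j)))               ≡⟨ cong (a *_) (sumWords-lookup n j g) ⟩
    a * (a ^ n * ∑[ y < a ] g y)                               ≡⟨ *-assoc a (a ^ n) _ ⟨
    a ^ suc n * ∑[ y < a ] g y                                 ∎
    where open ≡-Reasoning

  holesIn-suc : ∀ (w : PartialWord a) i n → holesIn w i (suc n) ≡ 𝟙-hole (w ! i) + holesIn w (suc i) n
  holesIn-suc w i n with w ! i
  ... | nothing = refl
  ... | just _  = refl

  ^-holesIn-suc : ∀ (w : PartialWord a) i n → a ^ 𝟙-hole (w ! i) * a ^ holesIn w (suc i) n ≡ a ^ holesIn w i (suc n)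
  ^-holesIn-suc w i n = trans (sym (^-distribˡ-+-* a (𝟙-hole (w ! i)) _)) (cong (a ^_) (sym (holesIn-suc w i n)))

  ∑-𝟙-covers : ∀ (w : PartialWord a) n i → sumWords n (𝟙-covers w i) ≡ a ^ holesIn w i n
  ∑-𝟙-covers w zero    i = refl
  ∑-𝟙-covers w (suc n) i = begin
    sumWords (suc n) (𝟙-covers w i)                                     ≡⟨ sumWords-∷-* n (𝟙-compatible (w ! i)) (𝟙-covers w (suc i)) ⟩
    (∑[ y < a ] 𝟙-compatible (w ! i) y) * sumWords n (𝟙-covers w (suc i)) ≡⟨ cong₂ _*_ (∑-𝟙-compatible (w ! i)) (∑-𝟙-covers w n (suc i)) ⟩
    a ^ 𝟙-hole (w ! i) * a ^ holesIn w (suc i) n                         ≡⟨ ^-holesIn-suc w i n ⟩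
    a ^ holesIn w i (suc n)                                              ∎
    where open ≡-Reasoning

  ∑-𝟙-covers-δ : ∀ (w : PartialWord a) n i c (j : Fin n) →
                 a * sumWords n (λ x → 𝟙-covers w i x * δ c (lookup x j)) ≡ a ^ holesIn w i n * columnWeight c (w ! (i + toℕ j))
  ∑-𝟙-covers-δ w (suc n) i c Fin.zero = begin
    a * sumWords (suc n) (λ x → 𝟙-covers w i x * δ c (Vec.head x))
      ≡⟨ cong (a *_) (sum-cong-≗ {a} λ y → sumWords-cong n λ x → xy∙z≈xz∙y *-commutativeSemigroup (𝟙-compatible (w ! i) y) _ _) ⟩
    a * sumWords (suc n) (λ x → (𝟙-compatible (w ! i) (Vec.head x) * δ c (Vec.head x)) * 𝟙-covers w (suc i) (Vec.tail x))
      ≡⟨ cong (a *_) (sumWords-∷-* n (λ y → 𝟙-compatible (w ! i) y * δ c y) (𝟙-covers w (suc i))) ⟩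
    a * ((∑[ y < a ] (𝟙-compatible (w ! i) y * δ c y)) * sumWords n (𝟙-covers w (suc i)))
      ≡⟨ *-assoc a (∑[ y < a ] (𝟙-compatible (w ! i) y * δ c y)) (sumWords n (𝟙-covers w (suc i))) ⟨
    a * (∑[ y < a ] (𝟙-compatible (w ! i) y * δ c y)) * sumWords n (𝟙-covers w (suc i))
      ≡⟨ cong₂ _*_ (∑-𝟙-compatible-δ c (w ! i)) (∑-𝟙-covers w n (suc i)) ⟩
    a ^ 𝟙-hole (w ! i) * columnWeight c (w ! i) * a ^ holesIn w (suc i) n
      ≡⟨ xy∙z≈xz∙y *-commutativeSemigroup (a ^ 𝟙-hole (w ! i)) (columnWeight c (w ! i)) _ ⟩
    a ^ 𝟙-hole (w ! i) * a ^ holesIn w (suc i) n * columnWeight c (w ! i)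
      ≡⟨ cong₂ _*_ (^-holesIn-suc w i n) (cong (λ k → columnWeight c (w ! k)) (sym (+-identityʳ i))) ⟩
    a ^ holesIn w i (suc n) * columnWeight c (w ! (i + 0))
      ∎
    where open ≡-Reasoning
  ∑-𝟙-covers-δ w (suc n) i c (Fin.suc j) = begin
    a * sumWords (suc n) (λ x → 𝟙-covers w i x * δ c (lookup x (Fin.suc j)))
      ≡⟨ cong (a *_) (sum-cong-≗ {a} λ y → sumWords-cong n λ x → *-assoc (𝟙-compatible (w ! i) y) _ _) ⟩
    a * sumWords (suc n) (λ x → 𝟙-compatible (w ! i) (Vec.head x) * (𝟙-covers w (suc i) (Vec.tail x) * δ c (lookup (Vec.tail x) j)))
      ≡⟨ cong (a *_) (sumWords-∷-* n (𝟙-compatible (w ! i)) _) ⟩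
    a * ((∑[ y < a ] 𝟙-compatible (w ! i) y) * sumWords n (λ x → 𝟙-covers w (suc i) x * δ c (lookup x j)))
      ≡⟨ x∙yz≈y∙xz *-commutativeSemigroup a (∑[ y < a ] 𝟙-compatible (w ! i) y) _ ⟩
    (∑[ y < a ] 𝟙-compatible (w ! i) y) * (a * sumWords n (λ x → 𝟙-covers w (suc i) x * δ c (lookup x j)))
      ≡⟨ cong₂ _*_ (∑-𝟙-compatible (w ! i)) (∑-𝟙-covers-δ w n (suc i) c j) ⟩
    a ^ 𝟙-hole (w ! i) * (a ^ holesIn w (suc i) n * columnWeight c (w ! (suc i + toℕ j)))
      ≡⟨ *-assoc (a ^ 𝟙-hole (w ! i)) _ _ ⟨
    a ^ 𝟙-hole (w ! i) * a ^ holesIn w (suc i) n * columnWeight c (w ! (suc i + toℕ j))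
      ≡⟨ cong₂ _*_ (^-holesIn-suc w i n) (cong (λ k → columnWeight c (w ! k)) (sym (+-suc i (toℕ j)))) ⟩
    a ^ holesIn w i (suc n) * columnWeight c (w ! (i + suc (toℕ j)))
      ∎
    where open ≡-Reasoning

  𝟙-covers≡0⊎CompatibleAt : ∀ {n} (w : PartialWord a) i (x : Vec (Fin a) n) → 𝟙-covers w i x ≡ 0 ⊎ CompatibleAt w i x
  𝟙-covers≡0⊎CompatibleAt w i []      = inj₂ λ ()
  𝟙-covers≡0⊎CompatibleAt w i (y ∷ x) with 𝟙-compatible≡0⊎Compatible (w ! i) y | 𝟙-covers≡0⊎CompatibleAt w (suc i) x
  ... | inj₁ head≡0 | _           = inj₁ (cong (_* 𝟙-covers w (suc i) x) head≡0)
  ... | inj₂ _      | inj₁ tail≡0 = inj₁ (trans (cong (𝟙-compatible (w ! i) y *_) tail≡0) (*-zeroʳ (𝟙-compatible (w ! i) y)))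
  ... | inj₂ y-ok   | inj₂ x-ok   = inj₂ λ where
    Fin.zero    → subst (λ k → Compatible (w ! k) y) (sym (+-identityʳ i)) y-ok
    (Fin.suc j) → subst (λ k → Compatible (w ! k) (lookup x j)) (sym (+-suc i (toℕ j))) (x-ok j)

  CompatibleAt⇒𝟙-covers≡1 : ∀ {n} (w : PartialWord a) i (x : Vec (Fin a) n) → CompatibleAt w i x → 𝟙-covers w i x ≡ 1
  CompatibleAt⇒𝟙-covers≡1 w i []      _  = refl
  CompatibleAt⇒𝟙-covers≡1 w i (y ∷ x) ok = cong₂ _*_
    (Compatible⇒𝟙-compatible≡1 (subst (λ k → Compatible (w ! k) y) (+-identityʳ i) (ok Fin.zero)))
    (CompatibleAt⇒𝟙-covers≡1 w (suc i) x λ j → subst (λ k → Compatible (w ! k) (lookup x j)) (+-suc i (toℕ j)) (ok (Fin.suc j)))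

  holesIn≡sumTo : ∀ (w : PartialWord a) i n → holesIn w i n ≡ sumTo n (λ t → 𝟙-hole (w ! (i + t)))
  holesIn≡sumTo w i zero    = refl
  holesIn≡sumTo w i (suc n) = begin
    holesIn w i (suc n)                                           ≡⟨ holesIn-suc w i n ⟩
    𝟙-hole (w ! i) + holesIn w (suc i) n                          ≡⟨ cong₂ _+_ (cong (𝟙-hole ∘ (w !_)) (sym (+-identityʳ i))) (holesIn≡sumTo w (suc i) n) ⟩
    𝟙-hole (w ! (i + 0)) + sumTo n (λ t → 𝟙-hole (w ! (suc i + t))) ≡⟨ cong (𝟙-hole (w ! (i + 0)) +_) (sumTo-cong n λ t _ → cong (𝟙-hole ∘ (w !_)) (sym (+-suc i t))) ⟩
    sumTo (suc n) (λ t → 𝟙-hole (w ! (i + t)))                    ∎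
    where open ≡-Reasoning

  holesIn≤ : ∀ (w : PartialWord a) i n → holesIn w i n ≤ n
  holesIn≤ w i n = begin
    holesIn w i n                                ≡⟨ holesIn≡sumTo w i n ⟩
    sumTo n (λ t → 𝟙-hole (w ! (i + t)))         ≤⟨ sumTo-mono-≤ n (λ t → 𝟙-hole≤1 (w ! (i + t))) ⟩
    sumTo n (λ _ → 1)                            ≡⟨ sumTo-const n 1 ⟩
    n * 1                                        ≡⟨ *-identityʳ n ⟩
    n                                            ∎
    where open ≤-Reasoning

  holesIn-full : ∀ (w : PartialWord a) i n → holesIn w i n ≡ n → ∀ t → t < n → w ! (i + t) ≡ nothing
  holesIn-full w i (suc n) full = allHoles (trans (sym (holesIn-suc w i n)) full)
    where
    allHoles : 𝟙-hole (w ! i) + holesIn w (suc i) n ≡ suc n → ∀ t → t < suc n → w ! (i + t) ≡ nothing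
    allHoles full′ t t<n with w ! i in wi≡◇
    ... | just _  = ⊥-elim (1+n≰n (subst (_≤ n) full′ (holesIn≤ w (suc i) n)))
    allHoles full′ zero    t<n | nothing = trans (cong (w !_) (+-identityʳ i)) wi≡◇
    allHoles full′ (suc t) t<n | nothing =
      trans (cong (w !_) (+-suc i t)) (holesIn-full w (suc i) n (suc-injective full′) t (s<s⁻¹ t<n))

all-◇⇒≡replicate : ∀ {a} (w : PartialWord a) → (∀ t → t < length w → w ! t ≡ nothing) → w ≡ replicate (length w) nothing
all-◇⇒≡replicate List.[]       _      = refl
all-◇⇒≡replicate (c List.∷ w) holes = cong₂ List._∷_ (holes 0 z<s) (all-◇⇒≡replicate w λ t t<n → holes (suc t) (s<s t<n))

a*x≢1+a*y : ∀ {a x y} → 2 ≤ a → a * x ≢ 1 + a * y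
a*x≢1+a*y {a} {x} {y} 2≤a ax≡1+ay = <⇒≢ 2≤a (sym (∣1⇒≡1 a∣1))
  where
  a∣1 : a ∣ 1
  a∣1 = ∣m+n∣m⇒∣n (subst (a ∣_) (trans ax≡1+ay (+-comm 1 (a * y))) (m∣m*n x)) (m∣m*n y)

indicator-≡-mod : ∀ {a h h′ l l′ u v} → 2 ≤ a → u ≤ 1 → v ≤ 1 →
                  h + a * l ≡ h′ + a * l′ → h′ + u ≡ h + v → u ≡ v
indicator-≡-mod _ z≤n       z≤n       _ _ = refl
indicator-≡-mod _ (s≤s z≤n) (s≤s z≤n) _ _ = refl
indicator-≡-mod {h = h} {h′} 2≤a z≤n (s≤s z≤n) eq h′≡h+1 = contradiction
  (+-cancelˡ-≡ h _ _ (trans eq (trans (cong (_+ _) (trans (sym (+-identityʳ h′)) h′≡h+1)) (+-assoc h 1 _))))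
  (a*x≢1+a*y 2≤a)
indicator-≡-mod {h = h} {h′} 2≤a (s≤s z≤n) z≤n eq h′+1≡h = contradiction
  (+-cancelˡ-≡ h′ _ _ (trans (sym eq) (trans (cong (_+ _) (trans (sym (+-identityʳ h)) (sym h′+1≡h))) (+-assoc h′ 1 _))))
  (a*x≢1+a*y 2≤a)

-- Universal partial words with diamondicity d

module _ {a n d : ℕ} .{{_ : NonZero a}} .{{_ : NonZero n}} {w : PartialWord a}
         (universal : Universal n w) (diamondicity : HasDiamondicity n w d) where

  someLetter : Fin a
  someLetter = Fin.fromℕ< (>-nonZero⁻¹ a)

  windows : ℕ
  windows = suc (length w ∸ n)

  n≤length : n ≤ length w
  n≤length = m+n≤o⇒n≤o _ (proj₁ (proj₁ (proj₂ (universal (Vec.replicate n someLetter)))))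

  <windows⇒fits : ∀ {i} → i < windows → i + n ≤ length w
  <windows⇒fits (s<s i≤N-n) = subst (_ ≤_) (m∸n+n≡m n≤length) (+-monoˡ-≤ n i≤N-n)

  fits⇒<windows : ∀ {i} → i + n ≤ length w → i < windows
  fits⇒<windows {i} fits = s<s (subst (_≤ length w ∸ n) (m+n∸n≡m i n) (∸-monoˡ-≤ n fits))

  ∑-𝟙-covers-windows : ∀ x → sumTo windows (λ i → 𝟙-covers w i x) ≡ 1
  ∑-𝟙-covers-windows x with universal x
  ... | i₀ , (fits , compatible) , unique =
    trans (sumTo-single windows (λ i → 𝟙-covers w i x) (fits⇒<windows fits) notCovering) (CompatibleAt⇒𝟙-covers≡1 w i₀ x compatible)
    where
    notCovering : ∀ i → i < windows → i ≢ i₀ → 𝟙-covers w i x ≡ 0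
    notCovering i i<windows i≢i₀ with 𝟙-covers≡0⊎CompatibleAt w i x
    ... | inj₁ ≡0        = ≡0
    ... | inj₂ compatible′ = contradiction (unique i (<windows⇒fits i<windows , compatible′)) i≢i₀

  doubleCount : ∀ (F : Vec (Fin a) n → ℕ) → sumTo windows (λ i → sumWords n (λ x → 𝟙-covers w i x * F x)) ≡ sumWords n F
  doubleCount F = begin
    sumTo windows (λ i → sumWords n (λ x → 𝟙-covers w i x * F x))   ≡⟨ sumWords-sumTo-comm n windows (λ i x → 𝟙-covers w i x * F x) ⟨
    sumWords n (λ x → sumTo windows (λ i → 𝟙-covers w i x * F x))   ≡⟨ sumWords-cong n (λ x → sumTo-*ʳ x) ⟩
    sumWords n (λ x → 1 * F x)                                       ≡⟨ sumWords-cong n (λ x → *-identityˡ (F x)) ⟩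
    sumWords n F                                                     ∎
    where
    open ≡-Reasoning
    sumTo-*ʳ : ∀ x → sumTo windows (λ i → 𝟙-covers w i x * F x) ≡ 1 * F x
    sumTo-*ʳ x = begin
      sumTo windows (λ i → 𝟙-covers w i x * F x)   ≡⟨ sumTo-cong windows (λ i _ → *-comm (𝟙-covers w i x) (F x)) ⟩
      sumTo windows (λ i → F x * 𝟙-covers w i x)   ≡⟨ *-distribˡ-sumTo windows (F x) (λ i → 𝟙-covers w i x) ⟨
      F x * sumTo windows (λ i → 𝟙-covers w i x)   ≡⟨ *-comm (F x) _ ⟩
      sumTo windows (λ i → 𝟙-covers w i x) * F x   ≡⟨ cong (_* F x) (∑-𝟙-covers-windows x) ⟩
      1 * F x                                      ∎

  windows*a^d≡a^n : windows * a ^ d ≡ a ^ n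
  windows*a^d≡a^n = begin
    windows * a ^ d                                                  ≡⟨ sumTo-const windows (a ^ d) ⟨
    sumTo windows (λ _ → a ^ d)                                      ≡⟨ sumTo-cong windows (λ i i<windows → windowCount i i<windows) ⟩
    sumTo windows (λ i → sumWords n (λ x → 𝟙-covers w i x * 1))      ≡⟨ doubleCount (λ _ → 1) ⟩
    sumWords n (λ _ → 1)                                             ≡⟨ sumWords-const n 1 ⟩
    a ^ n * 1                                                        ≡⟨ *-identityʳ (a ^ n) ⟩
    a ^ n                                                            ∎
    where
    open ≡-Reasoning
    windowCount : ∀ i → i < windows → a ^ d ≡ sumWords n (λ x → 𝟙-covers w i x * 1)
    windowCount i i<windows = begin
      a ^ d                                     ≡⟨ cong (a ^_) (diamondicity i (<windows⇒fits i<windows)) ⟨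
      a ^ holesIn w i n                         ≡⟨ ∑-𝟙-covers w n i ⟨
      sumWords n (𝟙-covers w i)                 ≡⟨ sumWords-cong n (λ x → *-identityʳ (𝟙-covers w i x)) ⟨
      sumWords n (λ x → 𝟙-covers w i x * 1)     ∎

  d≤n : d ≤ n
  d≤n = subst (_≤ n) (diamondicity 0 n≤length) (holesIn≤ w 0 n)

  windows≡a^[n∸d] : windows ≡ a ^ (n ∸ d)
  windows≡a^[n∸d] = *-cancelʳ-≡ windows (a ^ (n ∸ d)) (a ^ d) {{m^n≢0 a d}} (begin
    windows * a ^ d             ≡⟨ windows*a^d≡a^n ⟩
    a ^ n                       ≡⟨ cong (a ^_) (m∸n+n≡m d≤n) ⟨
    a ^ (n ∸ d + d)             ≡⟨ ^-distribˡ-+-* a (n ∸ d) d ⟩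
    a ^ (n ∸ d) * a ^ d         ∎)
    where open ≡-Reasoning

  -- Reading w through x % n sidesteps the junk value w ! k = nothing (a hole) beyond the end of w.
  holePattern : ℕ → ℕ
  holePattern x = 𝟙-hole (w ! (x % n))

  holePattern-period-n : Period holePattern n
  holePattern-period-n x = cong (𝟙-hole ∘ (w !_)) ([m+n]%n≡m%n x n)

  𝟙-hole≡holePattern : ∀ {k} → k < length w → 𝟙-hole (w ! k) ≡ holePattern k
  𝟙-hole≡holePattern = partialPeriod-% consecutiveWindows _
    where
    consecutiveWindows : ∀ i → i + n < length w → 𝟙-hole (w ! (i + n)) ≡ 𝟙-hole (w ! i)
    consecutiveWindows i i+n<N = +-cancelˡ-≡ d _ _ (begin
      d + 𝟙-hole (w ! (i + n))                                   ≡⟨ cong (_+ 𝟙-hole (w ! (i + n))) (diamondicity i (<⇒≤ i+n<N)) ⟨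
      holesIn w i n + 𝟙-hole (w ! (i + n))                       ≡⟨ cong (_+ 𝟙-hole (w ! (i + n))) (holesIn≡sumTo w i n) ⟩
      sumTo n (λ t → 𝟙-hole (w ! (i + t))) + 𝟙-hole (w ! (i + n)) ≡⟨ sumTo-init-last n _ ⟨
      sumTo (suc n) (λ t → 𝟙-hole (w ! (i + t)))                  ≡⟨ holesIn≡sumTo w i (suc n) ⟨
      holesIn w i (suc n)                                         ≡⟨ holesIn-suc w i n ⟩
      𝟙-hole (w ! i) + holesIn w (suc i) n                        ≡⟨ cong (_ +_) (diamondicity (suc i) i+n<N) ⟩
      𝟙-hole (w ! i) + d                                          ≡⟨ +-comm _ d ⟩
      d + 𝟙-hole (w ! i)                                          ∎)
      where open ≡-Reasoning

  d≡sumTo-holePattern : d ≡ sumTo n holePattern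
  d≡sumTo-holePattern = begin
    d                                       ≡⟨ diamondicity 0 n≤length ⟨
    holesIn w 0 n                           ≡⟨ holesIn≡sumTo w 0 n ⟩
    sumTo n (λ t → 𝟙-hole (w ! t))          ≡⟨ sumTo-cong n (λ t t<n → cong (𝟙-hole ∘ (w !_)) (sym (m<n⇒m%n≡m t<n))) ⟩
    sumTo n holePattern                     ∎
    where open ≡-Reasoning

  columnHoles : ℕ → ℕ
  columnHoles j = sumTo windows (λ i → holePattern (i + j))

  columnLetters : Fin a → ℕ → ℕ
  columnLetters c j = sumTo windows (λ i → 𝟙-letter c (w ! (i + j)))

  ∑-columnWeight : ∀ c {j} → j < n → a ^ d * sumTo windows (λ i → columnWeight c (w ! (i + j))) ≡ a ^ n
  ∑-columnWeight c {j} j<n = begin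
    a ^ d * sumTo windows (λ i → columnWeight c (w ! (i + j)))
      ≡⟨ *-distribˡ-sumTo windows (a ^ d) (λ i → columnWeight c (w ! (i + j))) ⟩
    sumTo windows (λ i → a ^ d * columnWeight c (w ! (i + j)))
      ≡⟨ sumTo-cong windows windowCount ⟩
    sumTo windows (λ i → a * sumWords n (λ x → 𝟙-covers w i x * δ c (lookup x jᶠ)))
      ≡⟨ *-distribˡ-sumTo windows a (λ i → sumWords n (λ x → 𝟙-covers w i x * δ c (lookup x jᶠ))) ⟨
    a * sumTo windows (λ i → sumWords n (λ x → 𝟙-covers w i x * δ c (lookup x jᶠ)))
      ≡⟨ cong (a *_) (doubleCount (λ x → δ c (lookup x jᶠ))) ⟩
    a * sumWords n (λ x → δ c (lookup x jᶠ))
      ≡⟨ sumWords-lookup n jᶠ (δ c) ⟩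
    a ^ n * ∑[ y < a ] δ c y
      ≡⟨ trans (cong (a ^ n *_) (∑-δ c)) (*-identityʳ (a ^ n)) ⟩
    a ^ n
      ∎
    where
    open ≡-Reasoning
    jᶠ = Fin.fromℕ< j<n

    windowCount : ∀ i → i < windows →
                  a ^ d * columnWeight c (w ! (i + j)) ≡ a * sumWords n (λ x → 𝟙-covers w i x * δ c (lookup x jᶠ))
    windowCount i i<windows = begin
      a ^ d * columnWeight c (w ! (i + j))
        ≡⟨ cong₂ (λ h k → a ^ h * columnWeight c (w ! (i + k)))
                 (sym (diamondicity i (<windows⇒fits i<windows))) (sym (toℕ-fromℕ< j<n)) ⟩
      a ^ holesIn w i n * columnWeight c (w ! (i + toℕ jᶠ))
        ≡⟨ ∑-𝟙-covers-δ w n i c jᶠ ⟨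
      a * sumWords n (λ x → 𝟙-covers w i x * δ c (lookup x jᶠ))
        ∎

  columnCount : ∀ c {j} → j < n → columnHoles j + a * columnLetters c j ≡ windows
  columnCount c {j} j<n = *-cancelˡ-≡ _ windows (a ^ d) {{m^n≢0 a d}} (begin
    a ^ d * (columnHoles j + a * columnLetters c j)
      ≡⟨ cong (λ h → a ^ d * (h + a * columnLetters c j)) columnHoles≡ ⟩
    a ^ d * (sumTo windows holes + a * sumTo windows letters)
      ≡⟨ cong (λ l → a ^ d * (sumTo windows holes + l)) (*-distribˡ-sumTo windows a letters) ⟩
    a ^ d * (sumTo windows holes + sumTo windows (λ i → a * letters i))
      ≡⟨ cong (a ^ d *_) (sumTo-distrib-+ windows holes (λ i → a * letters i)) ⟨
    a ^ d * sumTo windows (λ i → columnWeight c (w ! (i + j)))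
      ≡⟨ ∑-columnWeight c j<n ⟩
    a ^ n
      ≡⟨ trans (*-comm (a ^ d) windows) windows*a^d≡a^n ⟨
    a ^ d * windows
      ∎)
    where
    open ≡-Reasoning
    holes letters : ℕ → ℕ
    holes   i = 𝟙-hole (w ! (i + j))
    letters i = 𝟙-letter c (w ! (i + j))

    columnHoles≡ : columnHoles j ≡ sumTo windows holes
    columnHoles≡ = sumTo-cong windows λ i i<windows →
      sym (𝟙-hole≡holePattern (<-≤-trans (+-monoʳ-< i j<n) (<windows⇒fits i<windows)))

  columnHoles-residue : ∀ {j} → j ≤ n → Σ ℕ λ l → columnHoles j + a * l ≡ windows
  columnHoles-residue j≤n with m≤n⇒m<n∨m≡n j≤n
  ... | inj₁ j<n  = columnLetters someLetter _ , columnCount someLetter j<n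
  ... | inj₂ refl = columnLetters someLetter 0 ,
                    trans (cong (_+ a * columnLetters someLetter 0) columnHoles[n]≡columnHoles[0])
                          (columnCount someLetter (>-nonZero⁻¹ n))
    where
    columnHoles[n]≡columnHoles[0] : columnHoles n ≡ columnHoles 0
    columnHoles[n]≡columnHoles[0] =
      sumTo-cong windows λ i _ → trans (holePattern-period-n i) (cong holePattern (sym (+-identityʳ i)))

  columnHoles-slide : ∀ j → columnHoles (suc j) + holePattern j ≡ columnHoles j + holePattern (windows + j)
  columnHoles-slide j = begin
    columnHoles (suc j) + holePattern j
      ≡⟨ cong (_+ holePattern j) (sumTo-cong windows {g = column ∘ suc} λ i _ → cong holePattern (+-suc i j)) ⟩
    sumTo windows (column ∘ suc) + holePattern j
      ≡⟨ +-comm (sumTo windows (column ∘ suc)) (holePattern j) ⟩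
    sumTo (suc windows) column
      ≡⟨ sumTo-init-last windows column ⟩
    columnHoles j + holePattern (windows + j)
      ∎
    where
    open ≡-Reasoning
    column : ℕ → ℕ
    column i = holePattern (i + j)

  holePattern-period-windows : 2 ≤ a → Period holePattern windows
  holePattern-period-windows 2≤a = period-fromResidues holePattern-period-n λ j j<n →
    let (l , r) = columnHoles-residue (<⇒≤ j<n)
        (l′ , r′) = columnHoles-residue j<n
    in trans (cong holePattern (+-comm j windows))
             (sym (indicator-≡-mod 2≤a (𝟙-hole≤1 (w ! (j % n))) (𝟙-hole≤1 (w ! ((windows + j) % n)))
                                   (trans r (sym r′)) (columnHoles-slide j)))

  holePattern-period-gcd : 2 ≤ a → Period holePattern (gcd (a ^ (n ∸ d)) n)
  holePattern-period-gcd 2≤a = subst (λ m → Period holePattern (gcd m n)) windows≡a^[n∸d]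
                                     (period-gcd (holePattern-period-windows 2≤a) holePattern-period-n)

  d≡n⇒trivial : d ≡ n → w ≡ replicate n nothing
  d≡n⇒trivial d≡n = trans (all-◇⇒≡replicate w allHoles) (cong (λ m → replicate m nothing) length≡n)
    where
    length≡n : length w ≡ n
    length≡n = ≤-antisym (m∸n≡0⇒m≤n (suc-injective (trans windows≡a^[n∸d] (cong (a ^_) (trans (cong (n ∸_) d≡n) (n∸n≡0 n))))))
                         n≤length
    allHoles : ∀ t → t < length w → w ! t ≡ nothing
    allHoles t t<length = holesIn-full w 0 n (trans (diamondicity 0 n≤length) d≡n) t (subst (t <_) length≡n t<length)

  nontrivial⇒d*p≡k*n : ∀ {p} → 2 ≤ a → Nontrivial n w → gcd (a ^ (n ∸ d)) n ≡ p →
                       Σ ℕ λ k → 1 ≤ k × k < p × d * p ≡ k * n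
  nontrivial⇒d*p≡k*n {p} 2≤a (nontrivial , i◇ , i◇<length , w!i◇≡◇) gcd≡p
    with subst (_∣ n) gcd≡p (gcd[m,n]∣n (a ^ (n ∸ d)) n)
  ... | divides q n≡q*p = k , 1≤k , k<p , d*p≡k*n
    where
    open ≤-Reasoning
    k = sumTo p holePattern

    d≡q*k : d ≡ q * k
    d≡q*k = trans d≡sumTo-holePattern (trans (cong (λ m → sumTo m holePattern) n≡q*p)
                  (sumTo-period (subst (Period holePattern) gcd≡p (holePattern-period-gcd 2≤a)) q))

    1≤d : 1 ≤ d
    1≤d = begin
      1                     ≡⟨ cong 𝟙-hole w!i◇≡◇ ⟨
      𝟙-hole (w ! i◇)       ≡⟨ 𝟙-hole≡holePattern i◇<length ⟩
      holePattern i◇        ≡⟨ period-% holePattern-period-n i◇ ⟨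
      holePattern (i◇ % n)  ≤⟨ term≤sumTo n holePattern (m%n<n i◇ n) ⟩
      sumTo n holePattern   ≡⟨ d≡sumTo-holePattern ⟨
      d                     ∎

    1≤k : 1 ≤ k
    1≤k = n≢0⇒n>0 λ k≡0 → <⇒≢ 1≤d (sym (trans d≡q*k (trans (cong (q *_) k≡0) (*-zeroʳ q))))

    k≤p : k ≤ p
    k≤p = begin
      sumTo p holePattern   ≤⟨ sumTo-mono-≤ p (λ x → 𝟙-hole≤1 (w ! (x % n))) ⟩
      sumTo p (λ _ → 1)     ≡⟨ sumTo-const p 1 ⟩
      p * 1                 ≡⟨ *-identityʳ p ⟩
      p                     ∎

    k<p : k < p
    k<p = ≤∧≢⇒< k≤p λ k≡p → nontrivial (d≡n⇒trivial (trans d≡q*k (trans (cong (q *_) k≡p) (sym n≡q*p))))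

    d*p≡k*n : d * p ≡ k * n
    d*p≡k*n = begin-equality
      d * p          ≡⟨ cong (_* p) d≡q*k ⟩
      q * k * p      ≡⟨ cong (_* p) (*-comm q k) ⟩
      k * q * p      ≡⟨ *-assoc k q p ⟩
      k * (q * p)    ≡⟨ cong (k *_) n≡q*p ⟨
      k * n          ∎

corollary4p13 : (a n d p : ℕ) → 3 ≤ a → 1 ≤ n →
    gcd (a ^ (n ∸ d)) n ≡ p → Prime p →
    (w : PartialWord a) → Nontrivial n w → Universal n w → HasDiamondicity n w d →
    Σ ℕ (λ k → 1 ≤ k × k < p × d * p ≡ k * n)
corollary4p13 a n d p 3≤a 1≤n gcd≡p _ w nontrivial universal diamondicity =
  nontrivial⇒d*p≡k*n universal diamondicity (<⇒≤ 3≤a) nontrivial gcd≡p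
  where
  instance
    a≢0 : NonZero a
    a≢0 = >-nonZero (<-trans z<s 3≤a)
    n≢0 : NonZero n
    n≢0 = >-nonZero 1≤n
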